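{- Let $D$ be a connected digraph on $n$ vertices. The following are equivalent: (i) $\langle D\rangle$ is a free semilattice of degree $n-1$; (ii) $\langle D\rangle$ is inverse; (iii) $\langle D\rangle$ is commutative; (iv) $D$ is a fan. If any of these conditions holds, then $|\langle D\rangle|=2^{n-1}-1$.
   Context: For $a\neq b$ in $\{1,\ldots,n\}$, $(a\to b)$ denotes the transformation mapping $a$ to $b$ and fixing every other point; transformations are composed left to right. For a digraph $D$ on $\{1,\ldots,n\}$ (no loops, no multiple arcs), $\langle D\rangle$ is the semigroup generated by all $(a\to b)$ with $(a,b)$ an arc. Connected means the underlying undirected graph is connected. The free semilattice of degree $k$ is the semigroup of nonempty subsets of a $k$-element set under union. A semigroup is inverse if for each $x$ there is a unique $y$ with $xyx=x$ and $yxy=y$. A digraph on $n$ vertices is a fan ($n$-fan) if it is isomorphic to the digraph on $\{1,\ldots,n\}$ whose arcs are exactly $(i,n)$ for $1\le i\le n-1$. -}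

module Defs where

open import Data.Nat using (ℕ; zero; suc; _^_; _∸_)
open import Data.Fin using (Fin; _≟_; fromℕ)
open import Data.Fin.Subset using (Subset; _∪_; Nonempty)
open import Data.Fin.Permutation using (Permutation′; _⟨$⟩ʳ_)
open import Data.Vec using (Vec; lookup; tabulate)
open import Data.Bool using (Bool; true; false)
open import Data.List using (List; length)
open import Data.List.Membership.Propositional using (_∈_)
open import Data.List.Relation.Unary.Unique.Propositional using (Unique)
open import Data.Product using (Σ; ∃; _×_; _,_)
open import Relation.Nullary using (¬_; yes; no)
open import Relation.Binary.PropositionalEquality using (_≡_; _≢_)
open import Function.Bundles using (_⇔_)

-- Transformations of {0,…,n-1}, stored as the vector of images
-- (so that equality of transformations is propositional equality).
Transf : ℕ → Set
Transf n = Vec (Fin n) n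

-- composition left to right: (t · s)(x) = s (t x)
_·_ : ∀ {n} → Transf n → Transf n → Transf n
t · s = tabulate (λ x → lookup s (lookup t x))

elem : ∀ {n} → Fin n → Fin n → Transf n
elem a b = tabulate (λ x → Data.Bool.if isYes (x ≟ a) then b else x)
  where open import Relation.Nullary.Decidable using (isYes)

-- a digraph on Fin n: arc relation; no multiple arcs automatically
Digraph : ℕ → Set
Digraph n = Fin n → Fin n → Bool

Arc : ∀ {n} → Digraph n → Fin n → Fin n → Set
Arc D a b = D a b ≡ true

Loopless : ∀ {n} → Digraph n → Set
Loopless D = ∀ i → D i i ≡ false

-- connectivity of the underlying undirected graph
data Reach {n} (D : Digraph n) : Fin n → Fin n → Set where
  here : ∀ {a} → Reach D a a
  fwd  : ∀ {a b c} → Arc D a b → Reach D b c → Reach D a c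
  bwd  : ∀ {a b c} → Arc D b a → Reach D b c → Reach D a c

Connected : ∀ {n} → Digraph n → Set
Connected D = ∀ a b → Reach D a b

data ⟨_⟩∋_ {n} (D : Digraph n) : Transf n → Set where
  gen  : ∀ {a b} → Arc D a b → ⟨ D ⟩∋ elem a b
  comp : ∀ {t s} → ⟨ D ⟩∋ t → ⟨ D ⟩∋ s → ⟨ D ⟩∋ (t · s)

-- (i) ⟨D⟩ is isomorphic to the free semilattice of degree m
-- (nonempty subsets of Fin m under union)
IsoFreeSemilattice : ∀ {n} → Digraph n → ℕ → Set
IsoFreeSemilattice {n} D m =
  Σ ((t : Transf n) → ⟨ D ⟩∋ t → Subset m) λ φ →
      (∀ t (p q : ⟨ D ⟩∋ t) → φ t p ≡ φ t q)
    × (∀ t (p : ⟨ D ⟩∋ t) → Nonempty (φ t p))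
    × (∀ t s (p : ⟨ D ⟩∋ t) (q : ⟨ D ⟩∋ s) → φ t p ≡ φ s q → t ≡ s)
    × (∀ (S : Subset m) → Nonempty S → ∃ λ t → Σ (⟨ D ⟩∋ t) λ p → φ t p ≡ S)
    × (∀ t s (p : ⟨ D ⟩∋ t) (q : ⟨ D ⟩∋ s) → φ (t · s) (comp p q) ≡ φ t p ∪ φ s q)

IsInverse : ∀ {n} → Digraph n → Set
IsInverse D = ∀ x → ⟨ D ⟩∋ x →
  ∃ λ y → ⟨ D ⟩∋ y × (x · y) · x ≡ x × (y · x) · y ≡ y
        × (∀ z → ⟨ D ⟩∋ z → (x · z) · x ≡ x → (z · x) · z ≡ z → z ≡ y)

IsCommutative : ∀ {n} → Digraph n → Set
IsCommutative D = ∀ x y → ⟨ D ⟩∋ x → ⟨ D ⟩∋ y → x · y ≡ y · x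

StdFan : ∀ m → Digraph (suc m)
StdFan m i j with j ≟ fromℕ m | i ≟ fromℕ m
... | yes _ | no _ = true
... | _     | _    = false

IsFan : ∀ {m} → Digraph (suc m) → Set
IsFan {m} D = Σ (Permutation′ (suc m)) λ σ →
  ∀ a b → (Arc D a b ⇔ Arc (StdFan m) (σ ⟨$⟩ʳ a) (σ ⟨$⟩ʳ b))

HasCardinality : ∀ {n} → Digraph n → ℕ → Set
HasCardinality {n} D k = ∃ λ (xs : List (Transf n)) →
  Unique xs × (∀ t → (t ∈ xs ⇔ ⟨ D ⟩∋ t)) × length xs ≡ k

module Submission where

-- The equivalences are proved around the cycle  free ⇒ inverse ⇒ commutative
-- ⇒ fan ⇒ free.
--   * free ⇒ inverse: a semilattice (commutative, every element idempotent)
--     is inverse, each element being its own unique inverse.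
--   * inverse ⇒ commutative: in an inverse semigroup products of idempotents
--     are idempotent and idempotents commute; the generators (a → b) are
--     idempotent, so every element of ⟨D⟩ is, and ⟨D⟩ is commutative.
--   * commutative ⇒ fan: commuting generators rule out paths a → b → d and
--     forks a → b, a → d with b ≠ d; by connectivity all arcs then point to
--     one centre s, which is the fan shape up to relabelling.
--   * fan ⇒ free: with centre s, ⟨D⟩ consists exactly of the maps collapse S
--     sending a nonempty set S of non-centre points to s and fixing the rest;
--     collapse S · collapse S' = collapse (S ∪ S').
-- The cardinality holds for every free semilattice of degree m, by listing the
-- 2^m - 1 nonempty subsets of Fin m.

open import Defs
open import Algebra.Bundles using (Monoid)
import Algebra.Solver.Monoid as MonoidSolver
open import Data.Bool using (true; false; if_then_else_; _∨_)
open import Data.Bool.Properties using (¬-not)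
open import Data.Empty using (⊥; ⊥-elim)
open import Data.Fin using (Fin; zero; suc; _≟_; fromℕ; punchIn; punchOut)
open import Data.Fin.Permutation using (Permutation′; _⟨$⟩ʳ_; _⟨$⟩ˡ_; inverseˡ; inverseʳ; transpose)
open import Data.Fin.Properties using (punchIn-punchOut; punchOut-punchIn; punchInᵢ≢i; punchOut-cong; punchIn-injective)
open import Data.Fin.Subset using (Subset; _∪_; ⁅_⁆; Nonempty; inside; outside)
open import Data.Fin.Subset.Properties using (∪-idem; ∪-comm; ∪-identityˡ; p⊆p∪q; x∈⁅x⁆; x∈⁅y⁆⇒x≡y; nonempty?; Empty-unique)
open import Data.List using (List; []; _∷_; map; _++_; length)
open import Data.List.Membership.Propositional using () renaming (_∈_ to _∈ₗ_)
open import Data.List.Membership.Propositional.Properties using (∈-map⁺; ∈-map⁻; ∈-++⁺ˡ; ∈-++⁺ʳ; ∈-++⁻)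
open import Data.List.Properties using (length-map; length-++)
open import Data.List.Relation.Unary.Any using (here; there)
import Data.List.Relation.Unary.All as All
import Data.List.Relation.Unary.All.Properties as AllProperties
open import Data.List.Relation.Unary.AllPairs using ([]; _∷_)
open import Data.List.Relation.Unary.Unique.Propositional using (Unique)
import Data.List.Relation.Unary.Unique.Propositional.Properties as UniqueProperties
open import Data.Nat using (ℕ; zero; suc; _+_; _^_; _∸_)
open import Data.Nat.Properties using (+-∸-assoc; m^n>0; +-identityʳ)
open import Data.Product using (Σ; ∃; ∃₂; _×_; _,_; proj₁; proj₂)
open import Data.Product.Function.NonDependent.Propositional using (_×-⇔_)
open import Data.Sum using (_⊎_; inj₁; inj₂)
open import Data.Vec using (Vec; []; _∷_; lookup; tabulate; here; there)
open import Data.Vec.Properties using (lookup∘tabulate; tabulate∘lookup; tabulate-cong; lookup⇒[]=; []=⇒lookup; lookup-zipWith; ∷-injectiveʳ)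
open import Function using (_∘_)
open import Function.Bundles using (_⇔_; mk⇔; Equivalence)
import Function.Properties.Equivalence as ⇔
open import Relation.Nullary using (¬_; yes; no; contradiction)
open import Relation.Nullary.Decidable using (isYes; isYes≗does; dec-true; dec-false)
open import Relation.Binary.PropositionalEquality

open Equivalence using (to; from)

vec-ext : ∀ {A : Set} {k} {u v : Vec A k} → (∀ i → lookup u i ≡ lookup v i) → u ≡ v
vec-ext {u = u} {v} pointwise =
  trans (sym (tabulate∘lookup u)) (trans (tabulate-cong pointwise) (tabulate∘lookup v))

isYes-≡ : ∀ {n} {x y : Fin n} → x ≡ y → isYes (x ≟ y) ≡ true
isYes-≡ {x = x} {y} x≡y = trans (isYes≗does (x ≟ y)) (dec-true (x ≟ y) x≡y)

isYes-≢ : ∀ {n} {x y : Fin n} → x ≢ y → isYes (x ≟ y) ≡ false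
isYes-≢ {x = x} {y} x≢y = trans (isYes≗does (x ≟ y)) (dec-false (x ≟ y) x≢y)

¬-⇔ : ∀ {A B : Set} → A ⇔ B → (¬ A) ⇔ (¬ B)
¬-⇔ A⇔B = mk⇔ (λ ¬a b → ¬a (from A⇔B b)) (λ ¬b a → ¬b (to A⇔B a))

map-unique : ∀ {A B : Set} {f : A → B} {xs : List A} →
  (∀ {x y} → x ∈ₗ xs → y ∈ₗ xs → f x ≡ f y → x ≡ y) → Unique xs → Unique (map f xs)
map-unique injective [] = []
map-unique injective (x∉xs ∷ xs!) =
  AllProperties.map⁺ (All.tabulate λ y∈xs fx≡fy →
    All.lookup x∉xs y∈xs (injective (here refl) (there y∈xs) fx≡fy))
  ∷ map-unique (λ x∈ y∈ → injective (there x∈) (there y∈)) xs!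

module _ {n : ℕ} where

  lookup-· : (t u : Transf n) (x : Fin n) → lookup (t · u) x ≡ lookup u (lookup t x)
  lookup-· t u x = lookup∘tabulate _ x

  ·-assoc : (t u v : Transf n) → (t · u) · v ≡ t · (u · v)
  ·-assoc t u v = vec-ext λ x → begin
    lookup ((t · u) · v) x          ≡⟨ lookup-· (t · u) v x ⟩
    lookup v (lookup (t · u) x)     ≡⟨ cong (lookup v) (lookup-· t u x) ⟩
    lookup v (lookup u (lookup t x)) ≡⟨ sym (lookup-· u v (lookup t x)) ⟩
    lookup (u · v) (lookup t x)     ≡⟨ sym (lookup-· t (u · v) x) ⟩
    lookup (t · (u · v)) x          ∎
    where open ≡-Reasoning

  identity : Transf n
  identity = tabulate (λ x → x)

  -- The full transformation monoid; it is only used to run the monoid solver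
  -- on the reassociations in the inverse-semigroup argument.
  transformationMonoid : Monoid _ _
  transformationMonoid = record
    { Carrier = Transf n ; _≈_ = _≡_ ; _∙_ = _·_ ; ε = identity
    ; isMonoid = record
      { isSemigroup = record
        { isMagma = record { isEquivalence = isEquivalence ; ∙-cong = cong₂ _·_ }
        ; assoc = ·-assoc }
      ; identity = (λ t → vec-ext λ x → trans (lookup-· identity t x) (cong (lookup t) (lookup∘tabulate _ x)))
                 , (λ t → vec-ext λ x → trans (lookup-· t identity x) (lookup∘tabulate _ (lookup t x))) } }

  lookup-elem : (a b x : Fin n) → lookup (elem a b) x ≡ (if isYes (x ≟ a) then b else x)
  lookup-elem a b x = lookup∘tabulate _ x

  elem-at : (a b : Fin n) → lookup (elem a b) a ≡ b
  elem-at a b = trans (lookup-elem a b a) (cong (if_then b else a) (isYes-≡ refl))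

  elem-off : {a x : Fin n} (b : Fin n) → x ≢ a → lookup (elem a b) x ≡ x
  elem-off {a} {x} b x≢a = trans (lookup-elem a b x) (cong (if_then b else x) (isYes-≢ x≢a))

  elem-idempotent : {a b : Fin n} → a ≢ b → elem a b · elem a b ≡ elem a b
  elem-idempotent {a} {b} a≢b = vec-ext λ x → trans (lookup-· (elem a b) (elem a b) x) (twice x)
    where
    twice : ∀ x → lookup (elem a b) (lookup (elem a b) x) ≡ lookup (elem a b) x
    twice x with x ≟ a
    ... | yes refl = trans (cong (lookup (elem a b)) (elem-at a b))
                       (trans (elem-off b (a≢b ∘ sym)) (sym (elem-at a b)))
    ... | no x≢a = cong (lookup (elem a b)) (elem-off b x≢a)

  -- If (a → b) and (b → d) commute, then d = b  (evaluate both products at a).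
  elem-path-commute : {a b d : Fin n} → a ≢ b → elem a b · elem b d ≡ elem b d · elem a b → d ≡ b
  elem-path-commute {a} {b} {d} a≢b commute = begin
    d                                     ≡⟨ sym (elem-at b d) ⟩
    lookup (elem b d) b                   ≡⟨ cong (lookup (elem b d)) (sym (elem-at a b)) ⟩
    lookup (elem b d) (lookup (elem a b) a) ≡⟨ sym (lookup-· (elem a b) (elem b d) a) ⟩
    lookup (elem a b · elem b d) a        ≡⟨ cong (λ t → lookup t a) commute ⟩
    lookup (elem b d · elem a b) a        ≡⟨ lookup-· (elem b d) (elem a b) a ⟩
    lookup (elem a b) (lookup (elem b d) a) ≡⟨ cong (lookup (elem a b)) (elem-off d a≢b) ⟩
    lookup (elem a b) a                   ≡⟨ elem-at a b ⟩
    b                                     ∎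
    where open ≡-Reasoning

  elem-fork-commute : {a b d : Fin n} → a ≢ b → a ≢ d → elem a b · elem a d ≡ elem a d · elem a b → b ≡ d
  elem-fork-commute {a} {b} {d} a≢b a≢d commute = begin
    b                                     ≡⟨ sym (elem-off d (a≢b ∘ sym)) ⟩
    lookup (elem a d) b                   ≡⟨ cong (lookup (elem a d)) (sym (elem-at a b)) ⟩
    lookup (elem a d) (lookup (elem a b) a) ≡⟨ sym (lookup-· (elem a b) (elem a d) a) ⟩
    lookup (elem a b · elem a d) a        ≡⟨ cong (λ t → lookup t a) commute ⟩
    lookup (elem a d · elem a b) a        ≡⟨ lookup-· (elem a d) (elem a b) a ⟩
    lookup (elem a b) (lookup (elem a d) a) ≡⟨ cong (lookup (elem a b)) (elem-at a d) ⟩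
    lookup (elem a b) d                   ≡⟨ elem-off b (a≢d ∘ sym) ⟩
    d                                     ∎
    where open ≡-Reasoning

IsIdempotent : ∀ {n} → Transf n → Set
IsIdempotent t = t · t ≡ t

arc-irreflexive : ∀ {n} {D : Digraph n} → Loopless D → ∀ {a b} → Arc D a b → a ≢ b
arc-irreflexive {D = D} loopless {a} arc refl with trans (sym arc) (loopless a)
... | ()

InverseIn : ∀ {n} → (Transf n → Set) → Set
InverseIn P = ∀ x → P x →
  ∃ λ y → P y × (x · y) · x ≡ x × (y · x) · y ≡ y
        × (∀ z → P z → (x · z) · x ≡ x → (z · x) · z ≡ z → z ≡ y)

-- A semilattice (commutative, all elements idempotent) is inverse: every
-- element is its own unique inverse.
semilattice⇒inverse : ∀ {n} (P : Transf n → Set) →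
  (∀ {x} → P x → IsIdempotent x) → (∀ {x y} → P x → P y → x · y ≡ y · x) → InverseIn P
semilattice⇒inverse P idempotent commute x px = x , px , xxx , xxx , unique
  where
  open ≡-Reasoning
  xxx : (x · x) · x ≡ x
  xxx = trans (cong (_· x) (idempotent px)) (idempotent px)
  unique : ∀ z → P z → (x · z) · x ≡ x → (z · x) · z ≡ z → z ≡ x
  unique z pz xzx zxz = begin
    z                ≡⟨ sym zxz ⟩
    (z · x) · z      ≡⟨ cong (_· z) (commute pz px) ⟩
    (x · z) · z      ≡⟨ ·-assoc x z z ⟩
    x · (z · z)      ≡⟨ cong (x ·_) (idempotent pz) ⟩
    x · z            ≡⟨ commute px pz ⟩
    z · x            ≡⟨ cong (z ·_) (sym (idempotent px)) ⟩
    z · (x · x)      ≡⟨ sym (·-assoc z x x) ⟩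
    (z · x) · x      ≡⟨ cong (_· x) (commute pz px) ⟩
    (x · z) · x      ≡⟨ xzx ⟩
    x                ∎

-- Idempotents of an inverse subsemigroup form a commutative subsemigroup.
module InverseSubsemigroup {n : ℕ} (P : Transf n → Set)
  (P-· : ∀ {t u} → P t → P u → P (t · u)) (inverse : InverseIn P) where

  open MonoidSolver (transformationMonoid {n}) using (solve; _⊜_; _⊕_)
  open ≡-Reasoning

  inverse-unique : ∀ {x y z : Transf n} → P x → P y → P z →
    (x · y) · x ≡ x → (y · x) · y ≡ y → (x · z) · x ≡ x → (z · x) · z ≡ z → y ≡ z
  inverse-unique {x} px py pz xyx yxy xzx zxz with inverse x px
  ... | _ , _ , _ , _ , unique = trans (unique _ py xyx yxy) (sym (unique _ pz xzx zxz))

  self-inverse : ∀ {e : Transf n} → IsIdempotent e → (e · e) · e ≡ e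
  self-inverse {e} ee = trans (cong (_· e) ee) ee

  -- ef is idempotent: with b the inverse of a = ef, c = fbe is an idempotent
  -- inverse of a, so a and c are inverses of c and a = c.
  ·-idempotent : ∀ {e f : Transf n} → P e → P f → IsIdempotent e → IsIdempotent f → IsIdempotent (e · f)
  ·-idempotent {e} {f} pe pf ee ff with inverse (e · f) (P-· pe pf)
  ... | b , pb , aba , bab , _ = subst IsIdempotent (sym a≡c) cc
    where
    a c : Transf n
    a = e · f
    c = (f · b) · e
    cc : IsIdempotent c
    cc = begin
      ((f · b) · e) · ((f · b) · e)  ≡⟨ solve 3 (λ e f b → ((f ⊕ b) ⊕ e) ⊕ ((f ⊕ b) ⊕ e) ⊜ f ⊕ (((b ⊕ (e ⊕ f)) ⊕ b) ⊕ e)) refl e f b ⟩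
      f · (((b · a) · b) · e)        ≡⟨ cong (λ z → f · (z · e)) bab ⟩
      f · (b · e)                    ≡⟨ sym (·-assoc f b e) ⟩
      c                              ∎
    aca : (a · c) · a ≡ a
    aca = begin
      ((e · f) · ((f · b) · e)) · (e · f)  ≡⟨ solve 3 (λ e f b → ((e ⊕ f) ⊕ ((f ⊕ b) ⊕ e)) ⊕ (e ⊕ f) ⊜ e ⊕ ((f ⊕ f) ⊕ (b ⊕ ((e ⊕ e) ⊕ f)))) refl e f b ⟩
      e · ((f · f) · (b · ((e · e) · f)))  ≡⟨ cong₂ (λ u v → e · (u · (b · (v · f)))) ff ee ⟩
      e · (f · (b · (e · f)))              ≡⟨ solve 3 (λ e f b → e ⊕ (f ⊕ (b ⊕ (e ⊕ f))) ⊜ ((e ⊕ f) ⊕ b) ⊕ (e ⊕ f)) refl e f b ⟩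
      (a · b) · a                          ≡⟨ aba ⟩
      a                                    ∎
    cac : (c · a) · c ≡ c
    cac = begin
      (((f · b) · e) · (e · f)) · ((f · b) · e)  ≡⟨ solve 3 (λ e f b → (((f ⊕ b) ⊕ e) ⊕ (e ⊕ f)) ⊕ ((f ⊕ b) ⊕ e) ⊜ f ⊕ (b ⊕ ((e ⊕ e) ⊕ ((f ⊕ f) ⊕ (b ⊕ e))))) refl e f b ⟩
      f · (b · ((e · e) · ((f · f) · (b · e))))  ≡⟨ cong₂ (λ u v → f · (b · (u · (v · (b · e))))) ee ff ⟩
      f · (b · (e · (f · (b · e))))              ≡⟨ solve 3 (λ e f b → f ⊕ (b ⊕ (e ⊕ (f ⊕ (b ⊕ e)))) ⊜ ((f ⊕ b) ⊕ e) ⊕ ((f ⊕ b) ⊕ e)) refl e f b ⟩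
      c · c                                      ≡⟨ cc ⟩
      c                                          ∎
    pc : P c
    pc = P-· (P-· pf pb) pe
    a≡c : a ≡ c
    a≡c = inverse-unique pc (P-· pe pf) pc cac aca (self-inverse cc) (self-inverse cc)

  sandwich : ∀ {e f : Transf n} → IsIdempotent e → IsIdempotent f → ((e · f) · (f · e)) · (e · f) ≡ (e · f) · (e · f)
  sandwich {e} {f} ee ff = begin
    ((e · f) · (f · e)) · (e · f)  ≡⟨ solve 2 (λ e f → ((e ⊕ f) ⊕ (f ⊕ e)) ⊕ (e ⊕ f) ⊜ e ⊕ ((f ⊕ f) ⊕ ((e ⊕ e) ⊕ f))) refl e f ⟩
    e · ((f · f) · ((e · e) · f))  ≡⟨ cong₂ (λ u v → e · (u · (v · f))) ff ee ⟩
    e · (f · (e · f))              ≡⟨ sym (·-assoc e f (e · f)) ⟩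
    (e · f) · (e · f)              ∎

  -- Idempotents commute: ef and fe are both inverses of the idempotent ef.
  idempotents-commute : ∀ {e f : Transf n} → P e → P f → IsIdempotent e → IsIdempotent f → e · f ≡ f · e
  idempotents-commute {e} {f} pe pf ee ff =
    inverse-unique pef pef pfe (self-inverse efef) (self-inverse efef)
      (trans (sandwich ee ff) efef) (trans (sandwich ff ee) fefe)
    where
    pef = P-· pe pf
    pfe = P-· pf pe
    efef = ·-idempotent pe pf ee ff
    fefe = ·-idempotent pf pe ff ee

-- Inverse ⇒ commutative: ⟨D⟩ is generated by idempotents, hence consists of
-- idempotents, which commute.
inverse⇒commutative : ∀ {n} (D : Digraph n) → Loopless D → IsInverse D → IsCommutative D
inverse⇒commutative D loopless inverse x y px py =
  idempotents-commute px py (all-idempotent px) (all-idempotent py)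
  where
  open InverseSubsemigroup (⟨ D ⟩∋_) comp inverse
  all-idempotent : ∀ {t} → ⟨ D ⟩∋ t → IsIdempotent t
  all-idempotent (gen arc) = elem-idempotent (arc-irreflexive loopless arc)
  all-idempotent (comp p q) = ·-idempotent p q (all-idempotent p) (all-idempotent q)

cons-halves : ∀ {k} → List (Subset k) → List (Subset k) → List (Subset (suc k))
cons-halves xs ys = map (inside ∷_) xs ++ map (outside ∷_) ys

cons-halves-unique : ∀ {k} {xs ys : List (Subset k)} → Unique xs → Unique ys → Unique (cons-halves xs ys)
cons-halves-unique {xs = xs} {ys} xs! ys! =
  UniqueProperties.++⁺ (UniqueProperties.map⁺ ∷-injectiveʳ xs!) (UniqueProperties.map⁺ ∷-injectiveʳ ys!) disjoint
  where
  disjoint : ∀ {S} → ¬ (S ∈ₗ map (inside ∷_) xs × S ∈ₗ map (outside ∷_) ys)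
  disjoint (S∈xs , S∈ys) with ∈-map⁻ (inside ∷_) S∈xs | ∈-map⁻ (outside ∷_) S∈ys
  ... | _ , _ , refl | _ , _ , ()

cons-halves-length : ∀ {k} (xs ys : List (Subset k)) → length (cons-halves xs ys) ≡ length xs + length ys
cons-halves-length xs ys =
  trans (length-++ (map (inside ∷_) xs)) (cong₂ _+_ (length-map _ xs) (length-map _ ys))

subsets : ∀ k → List (Subset k)
subsets zero = [] ∷ []
subsets (suc k) = cons-halves (subsets k) (subsets k)

nonemptySubsets : ∀ k → List (Subset k)
nonemptySubsets zero = []
nonemptySubsets (suc k) = cons-halves (subsets k) (nonemptySubsets k)

∈-subsets : ∀ {k} (S : Subset k) → S ∈ₗ subsets k
∈-subsets [] = here refl
∈-subsets (inside ∷ S) = ∈-++⁺ˡ (∈-map⁺ (inside ∷_) (∈-subsets S))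
∈-subsets {suc k} (outside ∷ S) = ∈-++⁺ʳ (map (inside ∷_) (subsets k)) (∈-map⁺ (outside ∷_) (∈-subsets S))

nonempty⇒∈ : ∀ {k} (S : Subset k) → Nonempty S → S ∈ₗ nonemptySubsets k
nonempty⇒∈ (inside ∷ S) _ = ∈-++⁺ˡ (∈-map⁺ (inside ∷_) (∈-subsets S))
nonempty⇒∈ (outside ∷ S) (zero , ())
nonempty⇒∈ {suc k} (outside ∷ S) (suc i , there i∈S) =
  ∈-++⁺ʳ (map (inside ∷_) (subsets k)) (∈-map⁺ (outside ∷_) (nonempty⇒∈ S (i , i∈S)))

∈⇒nonempty : ∀ {k} {S : Subset k} → S ∈ₗ nonemptySubsets k → Nonempty S
∈⇒nonempty {suc k} S∈ with ∈-++⁻ (map (inside ∷_) (subsets k)) S∈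
... | inj₁ S∈₁ with ∈-map⁻ (inside ∷_) S∈₁
...   | _ , _ , refl = zero , here
∈⇒nonempty {suc k} S∈ | inj₂ S∈₂ with ∈-map⁻ (outside ∷_) S∈₂
...   | _ , T∈ , refl with ∈⇒nonempty T∈
...     | i , i∈T = suc i , there i∈T

subsets-unique : ∀ k → Unique (subsets k)
subsets-unique zero = All.[] ∷ []
subsets-unique (suc k) = cons-halves-unique (subsets-unique k) (subsets-unique k)

nonemptySubsets-unique : ∀ k → Unique (nonemptySubsets k)
nonemptySubsets-unique zero = []
nonemptySubsets-unique (suc k) = cons-halves-unique (subsets-unique k) (nonemptySubsets-unique k)

subsets-length : ∀ k → length (subsets k) ≡ 2 ^ k
subsets-length zero = refl
subsets-length (suc k) = begin
  length (cons-halves (subsets k) (subsets k)) ≡⟨ cons-halves-length (subsets k) (subsets k) ⟩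
  length (subsets k) + length (subsets k)      ≡⟨ cong₂ _+_ (subsets-length k) (subsets-length k) ⟩
  2 ^ k + 2 ^ k                                ≡⟨ cong (2 ^ k +_) (sym (+-identityʳ (2 ^ k))) ⟩
  2 ^ suc k                                    ∎
  where open ≡-Reasoning

nonemptySubsets-length : ∀ k → length (nonemptySubsets k) ≡ 2 ^ k ∸ 1
nonemptySubsets-length zero = refl
nonemptySubsets-length (suc k) = begin
  length (cons-halves (subsets k) (nonemptySubsets k))  ≡⟨ cons-halves-length (subsets k) (nonemptySubsets k) ⟩
  length (subsets k) + length (nonemptySubsets k)       ≡⟨ cong₂ _+_ (subsets-length k) (nonemptySubsets-length k) ⟩
  2 ^ k + (2 ^ k ∸ 1)                                   ≡⟨ sym (+-∸-assoc (2 ^ k) (m^n>0 2 k)) ⟩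
  (2 ^ k + 2 ^ k) ∸ 1                                   ≡⟨ cong (λ x → 2 ^ k + x ∸ 1) (sym (+-identityʳ (2 ^ k))) ⟩
  2 ^ suc k ∸ 1                                         ∎
  where open ≡-Reasoning

module FreeSemilattice {n : ℕ} (D : Digraph n) (k : ℕ) (iso : IsoFreeSemilattice D k) where

  φ : (t : Transf n) → ⟨ D ⟩∋ t → Subset k
  φ = proj₁ iso

  φ-irrelevant : ∀ t (p q : ⟨ D ⟩∋ t) → φ t p ≡ φ t q
  φ-irrelevant = proj₁ (proj₂ iso)

  φ-nonempty : ∀ t (p : ⟨ D ⟩∋ t) → Nonempty (φ t p)
  φ-nonempty = proj₁ (proj₂ (proj₂ iso))

  φ-injective : ∀ t u (p : ⟨ D ⟩∋ t) (q : ⟨ D ⟩∋ u) → φ t p ≡ φ u q → t ≡ u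
  φ-injective = proj₁ (proj₂ (proj₂ (proj₂ iso)))

  φ-surjective : ∀ S → Nonempty S → ∃ λ t → Σ (⟨ D ⟩∋ t) λ p → φ t p ≡ S
  φ-surjective = proj₁ (proj₂ (proj₂ (proj₂ (proj₂ iso))))

  φ-homomorphism : ∀ t u (p : ⟨ D ⟩∋ t) (q : ⟨ D ⟩∋ u) → φ (t · u) (comp p q) ≡ φ t p ∪ φ u q
  φ-homomorphism = proj₂ (proj₂ (proj₂ (proj₂ (proj₂ iso))))

  φ-cong : ∀ {t u} (p : ⟨ D ⟩∋ t) (q : ⟨ D ⟩∋ u) → t ≡ u → φ t p ≡ φ u q
  φ-cong {t} p q refl = φ-irrelevant t p q

  -- Union is idempotent and commutative, so ⟨D⟩ is a semilattice, hence inverse.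
  inverse : IsInverse D
  inverse = semilattice⇒inverse (⟨ D ⟩∋_) idempotent commutative
    where
    idempotent : ∀ {x} → ⟨ D ⟩∋ x → IsIdempotent x
    idempotent {x} p = φ-injective (x · x) x (comp p p) p
      (trans (φ-homomorphism x x p p) (∪-idem (φ x p)))
    commutative : ∀ {x y} → ⟨ D ⟩∋ x → ⟨ D ⟩∋ y → x · y ≡ y · x
    commutative {x} {y} p q = φ-injective (x · y) (y · x) (comp p q) (comp q p)
      (trans (φ-homomorphism x y p q) (trans (∪-comm (φ x p) (φ y q)) (sym (φ-homomorphism y x q p))))

  -- A chosen preimage of each nonempty subset.
  preimage : Subset k → Transf n
  preimage S with nonempty? S
  ... | yes neS = proj₁ (φ-surjective S neS)
  ... | no _ = identity

  preimage-spec : ∀ S → Nonempty S → Σ (⟨ D ⟩∋ preimage S) λ p → φ (preimage S) p ≡ S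
  preimage-spec S neS with nonempty? S
  ... | yes neS′ = proj₂ (φ-surjective S neS′)
  ... | no ¬neS = contradiction neS ¬neS

  cardinality : HasCardinality D (2 ^ k ∸ 1)
  cardinality = map preimage (nonemptySubsets k)
              , map-unique preimage-injective (nonemptySubsets-unique k)
              , (λ t → mk⇔ (listed⇒member t) (member⇒listed t))
              , trans (length-map preimage (nonemptySubsets k)) (nonemptySubsets-length k)
    where
    preimage-injective : ∀ {S S′} → S ∈ₗ nonemptySubsets k → S′ ∈ₗ nonemptySubsets k →
      preimage S ≡ preimage S′ → S ≡ S′
    preimage-injective S∈ S′∈ same with preimage-spec _ (∈⇒nonempty S∈) | preimage-spec _ (∈⇒nonempty S′∈)
    ... | p , φS | p′ , φS′ = trans (sym φS) (trans (φ-cong p p′ same) φS′)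
    listed⇒member : ∀ t → t ∈ₗ map preimage (nonemptySubsets k) → ⟨ D ⟩∋ t
    listed⇒member t t∈ with ∈-map⁻ preimage t∈
    ... | S , S∈ , refl = proj₁ (preimage-spec S (∈⇒nonempty S∈))
    member⇒listed : ∀ t → ⟨ D ⟩∋ t → t ∈ₗ map preimage (nonemptySubsets k)
    member⇒listed t p = subst (_∈ₗ map preimage (nonemptySubsets k)) preimage≡t
      (∈-map⁺ preimage (nonempty⇒∈ (φ t p) (φ-nonempty t p)))
      where
      preimage≡t : preimage (φ t p) ≡ t
      preimage≡t with preimage-spec (φ t p) (φ-nonempty t p)
      ... | p′ , φp′ = φ-injective _ t p′ p φp′

FanWithCentre : ∀ {n} → Digraph n → Fin n → Set
FanWithCentre D s = ∀ a b → Arc D a b ⇔ (b ≡ s × a ≢ s)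

-- Commutativity forces a fan: by connectivity every vertex other than s is
-- joined to the head s of some arc, and arcs can only point to s.
module Commutative {n : ℕ} (D : Digraph n) (loopless : Loopless D)
  (connected : Connected D) (commutative : IsCommutative D) where

  -- No path a → b → d: the generators (a → b), (b → d) would not commute.
  no-path-of-length-two : ∀ {a b d} → Arc D a b → Arc D b d → ⊥
  no-path-of-length-two ab bd = arc-irreflexive loopless bd
    (sym (elem-path-commute (arc-irreflexive loopless ab) (commutative _ _ (gen ab) (gen bd))))

  out-arcs-share-head : ∀ {a b d} → Arc D a b → Arc D a d → b ≡ d
  out-arcs-share-head ab ad = elem-fork-commute (arc-irreflexive loopless ab) (arc-irreflexive loopless ad)
    (commutative _ _ (gen ab) (gen ad))

  -- Once some arc points to s, the property "x = s or x → s" spreads along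
  -- undirected paths.
  module _ {s a₀ : Fin n} (a₀s : Arc D a₀ s) where

    AtOrToCentre : Fin n → Set
    AtOrToCentre x = x ≡ s ⊎ Arc D x s

    spread : ∀ {x y} → AtOrToCentre x → Reach D x y → AtOrToCentre y
    spread near here = near
    spread (inj₁ refl) (fwd sy _) = ⊥-elim (no-path-of-length-two a₀s sy)
    spread (inj₂ xs) (fwd xy path) = spread (inj₁ (sym (out-arcs-share-head xs xy))) path
    spread (inj₁ refl) (bwd ys path) = spread (inj₂ ys) path
    spread (inj₂ xs) (bwd yx _) = ⊥-elim (no-path-of-length-two yx xs)

    fan-at-head : FanWithCentre D s
    fan-at-head a b = mk⇔ arc⇒toCentre toCentre⇒arc
      where
      a-near-centre : AtOrToCentre a
      a-near-centre = spread (inj₁ refl) (connected s a)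
      arc⇒toCentre : Arc D a b → b ≡ s × a ≢ s
      arc⇒toCentre ab with a-near-centre
      ... | inj₁ refl = ⊥-elim (no-path-of-length-two a₀s ab)
      ... | inj₂ as = sym (out-arcs-share-head as ab) , arc-irreflexive loopless as
      toCentre⇒arc : b ≡ s × a ≢ s → Arc D a b
      toCentre⇒arc (refl , a≢s) with a-near-centre
      ... | inj₁ a≡s = contradiction a≡s a≢s
      ... | inj₂ as = as

some-arc : ∀ {n} {D : Digraph n} {a c} → Reach D a c → a ≢ c → ∃₂ (Arc D)
some-arc here a≢a = contradiction refl a≢a
some-arc (fwd ab _) _ = _ , _ , ab
some-arc (bwd ba _) _ = _ , _ , ba

-- A commutative ⟨D⟩ makes D a fan: on one vertex trivially, otherwise with
-- centre the head of any arc.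
commutative⇒fanWithCentre : ∀ {m} (D : Digraph (suc m)) → Loopless D → Connected D → IsCommutative D →
  ∃ (FanWithCentre D)
commutative⇒fanWithCentre {zero} D loopless _ _ = zero , λ { zero zero →
  mk⇔ (λ arc → contradiction refl (arc-irreflexive {D = D} loopless arc)) (λ (_ , 0≢0) → contradiction refl 0≢0) }
commutative⇒fanWithCentre {suc m} D loopless connected commutative
  with some-arc (connected zero (suc zero)) (λ ())
... | _ , s , a₀s = s , Commutative.fan-at-head D loopless connected commutative a₀s

stdFan-centre : ∀ m → FanWithCentre (StdFan m) (fromℕ m)
stdFan-centre m i j = mk⇔ (arc⇒toCentre i j) (λ (j≡c , i≢c) → toCentre⇒arc i j j≡c i≢c)
  where
  arc⇒toCentre : ∀ i j → Arc (StdFan m) i j → j ≡ fromℕ m × i ≢ fromℕ m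
  arc⇒toCentre i j arc with j ≟ fromℕ m | i ≟ fromℕ m
  arc⇒toCentre i j arc  | yes j≡c | no i≢c = j≡c , i≢c
  arc⇒toCentre i j ()   | yes _   | yes _
  arc⇒toCentre i j ()   | no _    | _
  toCentre⇒arc : ∀ i j → j ≡ fromℕ m → i ≢ fromℕ m → Arc (StdFan m) i j
  toCentre⇒arc i j j≡c i≢c with j ≟ fromℕ m | i ≟ fromℕ m
  ... | yes _   | no _    = refl
  ... | yes _   | yes i≡c = contradiction i≡c i≢c
  ... | no j≢c  | _       = contradiction j≡c j≢c

permutation-fibre : ∀ {k} (σ : Permutation′ k) {s c : Fin k} → σ ⟨$⟩ʳ s ≡ c →
  ∀ x → (σ ⟨$⟩ʳ x ≡ c) ⇔ (x ≡ s)
permutation-fibre σ {s} σs≡c x = mk⇔ fibre (λ { refl → σs≡c })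
  where
  fibre : σ ⟨$⟩ʳ x ≡ _ → x ≡ s
  fibre σx≡c = begin
    x                     ≡⟨ sym (inverseˡ σ) ⟩
    σ ⟨$⟩ˡ (σ ⟨$⟩ʳ x)     ≡⟨ cong (σ ⟨$⟩ˡ_) (trans σx≡c (sym σs≡c)) ⟩
    σ ⟨$⟩ˡ (σ ⟨$⟩ʳ s)     ≡⟨ inverseˡ σ ⟩
    s                     ∎
    where open ≡-Reasoning

fan-relabel : ∀ {m} (D : Digraph (suc m)) (σ : Permutation′ (suc m)) {s} → σ ⟨$⟩ʳ s ≡ fromℕ m →
  (∀ a b → Arc D a b ⇔ Arc (StdFan m) (σ ⟨$⟩ʳ a) (σ ⟨$⟩ʳ b)) ⇔ FanWithCentre D s
fan-relabel {m} D σ σs≡c =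
  mk⇔ (λ iso a b → ⇔.trans (iso a b) (std-arc a b)) (λ fan a b → ⇔.trans (fan a b) (⇔.sym (std-arc a b)))
  where
  std-arc : ∀ a b → Arc (StdFan m) (σ ⟨$⟩ʳ a) (σ ⟨$⟩ʳ b) ⇔ (b ≡ _ × a ≢ _)
  std-arc a b = ⇔.trans (stdFan-centre m _ _)
    (permutation-fibre σ σs≡c b ×-⇔ ¬-⇔ (permutation-fibre σ σs≡c a))

transpose-sends : ∀ {k} (i j : Fin k) → transpose i j ⟨$⟩ʳ i ≡ j
transpose-sends i j with i ≟ i
... | yes _ = refl
... | no i≢i = contradiction refl i≢i

isFan⇔fanWithCentre : ∀ {m} (D : Digraph (suc m)) → IsFan D ⇔ ∃ (FanWithCentre D)
isFan⇔fanWithCentre {m} D = mk⇔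
  (λ (σ , iso) → σ ⟨$⟩ˡ fromℕ m , to (fan-relabel D σ (inverseʳ σ)) iso)
  (λ (s , fan) → transpose s (fromℕ m) , from (fan-relabel D (transpose s (fromℕ m)) (transpose-sends s (fromℕ m))) fan)

nonempty-induction : ∀ {k} (P : Subset k → Set) → (∀ i → P ⁅ i ⁆) →
  (∀ A B → P A → P B → P (A ∪ B)) → ∀ S → Nonempty S → P S
nonempty-induction {zero} P singleton union [] (() , _)
nonempty-induction {suc k} P singleton union (b ∷ S) = cons-case b
  where
  tail-case : Nonempty S → P (outside ∷ S)
  tail-case = nonempty-induction (λ T → P (outside ∷ T)) (singleton ∘ suc)
    (λ A B → union (outside ∷ A) (outside ∷ B)) S
  cons-case : ∀ b → Nonempty (b ∷ S) → P (b ∷ S)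
  cons-case outside (zero , ())
  cons-case outside (suc i , there i∈S) = tail-case (i , i∈S)
  cons-case inside _ with nonempty? S
  ... | yes neS = subst (λ T → P (inside ∷ T)) (∪-identityˡ S)
                    (union ⁅ zero ⁆ (outside ∷ S) (singleton zero) (tail-case neS))
  ... | no ¬neS = subst (λ T → P (inside ∷ T)) (sym (Empty-unique ¬neS)) (singleton zero)

Nonempty-∪ : ∀ {k} {A : Subset k} (B : Subset k) → Nonempty A → Nonempty (A ∪ B)
Nonempty-∪ B (i , i∈A) = i , p⊆p∪q B i∈A

-- Transformations of Fin (suc m) that fix a centre s; the other points are
-- indexed by Fin m through point = punchIn s.
module Collapse {m : ℕ} (s : Fin (suc m)) where

  point : Fin m → Fin (suc m)
  point = punchIn s

  data Position : Fin (suc m) → Set where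
    centre : Position s
    outer  : (i : Fin m) → Position (point i)

  position : ∀ x → Position x
  position x with s ≟ x
  ... | yes refl = centre
  ... | no s≢x = subst Position (punchIn-punchOut s≢x) (outer (punchOut s≢x))

  ext-by-position : {t u : Transf (suc m)} → lookup t s ≡ lookup u s →
    (∀ i → lookup t (point i) ≡ lookup u (point i)) → t ≡ u
  ext-by-position {t} {u} at-centre at-points = vec-ext λ x → by-position (position x)
    where
    by-position : ∀ {x} → Position x → lookup t x ≡ lookup u x
    by-position centre = at-centre
    by-position (outer i) = at-points i

  collapseAt : Subset m → Fin (suc m) → Fin (suc m)
  collapseAt S x with s ≟ x
  ... | yes _ = s
  ... | no s≢x = if lookup S (punchOut s≢x) then s else x

  collapse : Subset m → Transf (suc m)
  collapse S = tabulate (collapseAt S)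

  collapse-centre : ∀ S → lookup (collapse S) s ≡ s
  collapse-centre S = trans (lookup∘tabulate (collapseAt S) s) at-centre
    where
    at-centre : collapseAt S s ≡ s
    at-centre with s ≟ s
    ... | yes _ = refl
    ... | no s≢s = contradiction refl s≢s

  collapse-point : ∀ S i → lookup (collapse S) (point i) ≡ (if lookup S i then s else point i)
  collapse-point S i = trans (lookup∘tabulate (collapseAt S) (point i)) at-point
    where
    at-point : collapseAt S (point i) ≡ (if lookup S i then s else point i)
    at-point with s ≟ point i
    ... | yes s≡i = contradiction (sym s≡i) (punchInᵢ≢i s i)
    ... | no _ = cong (λ j → if lookup S j then s else point i)
                   (trans (punchOut-cong s refl) (punchOut-punchIn s))

  collapsed : Transf (suc m) → Subset m
  collapsed t = tabulate (λ i → isYes (lookup t (point i) ≟ s))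

  collapsed-collapse : ∀ S → collapsed (collapse S) ≡ S
  collapsed-collapse S = vec-ext λ i →
    trans (lookup∘tabulate _ i) (trans (cong (λ y → isYes (y ≟ s)) (collapse-point S i)) (decide i (lookup S i)))
    where
    decide : ∀ i b → isYes ((if b then s else point i) ≟ s) ≡ b
    decide i true = isYes-≡ refl
    decide i false = isYes-≢ (punchInᵢ≢i s i)

  collapse-∪ : ∀ S S′ → collapse S · collapse S′ ≡ collapse (S ∪ S′)
  collapse-∪ S S′ = ext-by-position
    (trans (lookup-· (collapse S) (collapse S′) s)
      (trans (cong (lookup (collapse S′)) (collapse-centre S))
        (trans (collapse-centre S′) (sym (collapse-centre (S ∪ S′))))))
    at-point
    where
    open ≡-Reasoning
    after : ∀ i b → lookup (collapse S′) (if b then s else point i) ≡ (if b ∨ lookup S′ i then s else point i)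
    after i true = collapse-centre S′
    after i false = collapse-point S′ i
    at-point : ∀ i → lookup (collapse S · collapse S′) (point i) ≡ lookup (collapse (S ∪ S′)) (point i)
    at-point i = begin
      lookup (collapse S · collapse S′) (point i)              ≡⟨ lookup-· (collapse S) (collapse S′) (point i) ⟩
      lookup (collapse S′) (lookup (collapse S) (point i))     ≡⟨ cong (lookup (collapse S′)) (collapse-point S i) ⟩
      lookup (collapse S′) (if lookup S i then s else point i) ≡⟨ after i (lookup S i) ⟩
      (if lookup S i ∨ lookup S′ i then s else point i)        ≡⟨ cong (if_then s else point i) (sym (lookup-zipWith _∨_ i S S′)) ⟩
      (if lookup (S ∪ S′) i then s else point i)               ≡⟨ sym (collapse-point (S ∪ S′) i) ⟩
      lookup (collapse (S ∪ S′)) (point i)                     ∎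

  collapse-singleton : ∀ i → collapse ⁅ i ⁆ ≡ elem (point i) s
  collapse-singleton i = ext-by-position
    (trans (collapse-centre ⁅ i ⁆) (sym (elem-off s (punchInᵢ≢i s i ∘ sym))))
    at-point
    where
    at-point : ∀ j → lookup (collapse ⁅ i ⁆) (point j) ≡ lookup (elem (point i) s) (point j)
    at-point j with j ≟ i
    ... | yes refl = trans (collapse-point ⁅ i ⁆ i)
                       (trans (cong (if_then s else point i) ([]=⇒lookup (x∈⁅x⁆ i))) (sym (elem-at (point i) s)))
    ... | no j≢i = trans (collapse-point ⁅ i ⁆ j)
                     (trans (cong (if_then s else point j) (¬-not (j≢i ∘ x∈⁅y⁆⇒x≡y i ∘ lookup⇒[]= j ⁅ i ⁆)))
                       (sym (elem-off s (j≢i ∘ punchIn-injective s j i))))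

module FanSemigroup {m : ℕ} (D : Digraph (suc m)) (s : Fin (suc m)) (fan : FanWithCentre D s) where
  open Collapse s

  member⇒collapse : ∀ {t} → ⟨ D ⟩∋ t → ∃ λ S → Nonempty S × t ≡ collapse S
  member⇒collapse (gen {a} arc) with to (fan a _) arc
  ... | refl , a≢s with position a
  ...   | centre = contradiction refl a≢s
  ...   | outer i = ⁅ i ⁆ , (i , x∈⁅x⁆ i) , sym (collapse-singleton i)
  member⇒collapse (comp p q) with member⇒collapse p | member⇒collapse q
  ... | S , neS , refl | S′ , _ , refl = S ∪ S′ , Nonempty-∪ S′ neS , collapse-∪ S S′

  collapse⇒member : ∀ S → Nonempty S → ⟨ D ⟩∋ collapse S
  collapse⇒member = nonempty-induction (λ S → ⟨ D ⟩∋ collapse S)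
    (λ i → subst (⟨ D ⟩∋_) (sym (collapse-singleton i)) (gen (from (fan (point i) s) (refl , punchInᵢ≢i s i))))
    (λ A B pA pB → subst (⟨ D ⟩∋_) (collapse-∪ A B) (comp pA pB))

  member-recovered : ∀ {t} → ⟨ D ⟩∋ t → t ≡ collapse (collapsed t)
  member-recovered p with member⇒collapse p
  ... | S , _ , refl = cong collapse (sym (collapsed-collapse S))

  collapsed-nonempty : ∀ {t} → ⟨ D ⟩∋ t → Nonempty (collapsed t)
  collapsed-nonempty p with member⇒collapse p
  ... | S , neS , refl = subst Nonempty (sym (collapsed-collapse S)) neS

  collapsed-· : ∀ {t u} → ⟨ D ⟩∋ t → ⟨ D ⟩∋ u → collapsed (t · u) ≡ collapsed t ∪ collapsed u
  collapsed-· p q with member⇒collapse p | member⇒collapse q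
  ... | S , _ , refl | S′ , _ , refl = begin
    collapsed (collapse S · collapse S′)                 ≡⟨ cong collapsed (collapse-∪ S S′) ⟩
    collapsed (collapse (S ∪ S′))                        ≡⟨ collapsed-collapse (S ∪ S′) ⟩
    S ∪ S′                                               ≡⟨ sym (cong₂ _∪_ (collapsed-collapse S) (collapsed-collapse S′)) ⟩
    collapsed (collapse S) ∪ collapsed (collapse S′)     ∎
    where open ≡-Reasoning

  free : IsoFreeSemilattice D m
  free = (λ t _ → collapsed t)
       , (λ _ _ _ → refl)
       , (λ _ → collapsed-nonempty)
       , (λ _ _ p q same → trans (member-recovered p) (trans (cong collapse same) (sym (member-recovered q))))
       , (λ S neS → collapse S , collapse⇒member S neS , collapsed-collapse S)
       , (λ _ _ → collapsed-·)

proposition5p3 : (m : ℕ) (D : Digraph (suc m)) → Loopless D → Connected D →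
    (IsoFreeSemilattice D m ⇔ IsInverse D)
    × (IsInverse D ⇔ IsCommutative D)
    × (IsCommutative D ⇔ IsFan D)
    × (IsoFreeSemilattice D m → HasCardinality D (2 ^ m ∸ 1))
proposition5p3 m D loopless connected =
    mk⇔ free⇒inverse (commutative⇒free ∘ inverse⇒commutative′)
  , mk⇔ inverse⇒commutative′ (free⇒inverse ∘ commutative⇒free)
  , mk⇔ (from (isFan⇔fanWithCentre D) ∘ centre)
        (inverse⇒commutative′ ∘ free⇒inverse ∘ fanWithCentre⇒free ∘ to (isFan⇔fanWithCentre D))
  , FreeSemilattice.cardinality D m
  where
  free⇒inverse : IsoFreeSemilattice D m → IsInverse D
  free⇒inverse = FreeSemilattice.inverse D m
  inverse⇒commutative′ : IsInverse D → IsCommutative D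
  inverse⇒commutative′ = inverse⇒commutative D loopless
  centre : IsCommutative D → ∃ (FanWithCentre D)
  centre = commutative⇒fanWithCentre D loopless connected
  fanWithCentre⇒free : ∃ (FanWithCentre D) → IsoFreeSemilattice D m
  fanWithCentre⇒free (s , fan) = FanSemigroup.free D s fan
  commutative⇒free : IsCommutative D → IsoFreeSemilattice D m
  commutative⇒free = fanWithCentre⇒free ∘ centre
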